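{- If $D\in\mathcal{F}$, then for every $v_a\in H_a$ there is an arc $v_a\to a$, and for every $v_b\in H_b$ there is an arc $v_b\to b$.
   Context: An oriented graph is a loopless directed graph with no pair of opposite arcs. Strong diameter $2$: for every ordered pair of distinct vertices $(i,j)$ there is a directed path from $i$ to $j$ of length at most $2$. 2-connected: strong connectivity at least $2$. Paths are simple directed paths; "internal vertices" of a path are those other than its endpoints. $\mathcal{F}$ is the set of 2-connected oriented graphs $D$ with strong diameter $2$ having six distinct vertices $p,q,a,b,c,r$ such that: arcs $p\to c$, $q\to c$, $q\to b$, $b\to r$, $a\to r$, $p\to a$ are present; every directed path from $p$ to $r$ contains $a$ or contains both $c$ and $b$; every directed path from $q$ to $r$ contains $b$ or contains both $c$ and $a$; every directed path from $c$ to $r$ contains $a$ or $b$. With respect to these vertices: $H_a$ is the set of internal vertices of directed paths from $p$ to $a$ not using $c$; $H_b$ is the set of internal vertices of directed paths from $q$ to $b$ not using $c$. -}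

module Defs where

open import Data.Nat using (ℕ; _≥_)
open import Data.Fin using (Fin)
open import Data.Bool using (Bool; T)
open import Data.List using (List; []; _∷_; _++_)
open import Data.List.Membership.Propositional using (_∈_; _∉_)
open import Data.List.Relation.Unary.Unique.Propositional using (Unique)
open import Data.Product using (Σ; _×_; ∃-syntax)
open import Data.Sum using (_⊎_)
open import Relation.Nullary using (¬_)
open import Relation.Binary.PropositionalEquality using (_≡_; _≢_)

record Digraph : Set where
  field
    n   : ℕ
    adj : Fin n → Fin n → Bool

open Digraph public

Vertex : Digraph → Set
Vertex D = Fin (n D)

Arc : (D : Digraph) → Vertex D → Vertex D → Set
Arc D u v = T (adj D u v)

Oriented : Digraph → Set
Oriented D = (∀ u → ¬ Arc D u u) × (∀ u v → Arc D u v → ¬ Arc D v u)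

-- ArcChain D u ws v : u → w₁ → … → wₖ → v is a directed walk with
-- internal vertex list ws = w₁ … wₖ.
ArcChain : (D : Digraph) → Vertex D → List (Vertex D) → Vertex D → Set
ArcChain D u []       v = Arc D u v
ArcChain D u (w ∷ ws) v = Arc D u w × ArcChain D w ws v

pathVertices : {D : Digraph} → Vertex D → List (Vertex D) → Vertex D → List (Vertex D)
pathVertices u ws v = u ∷ ws ++ v ∷ []

Path : (D : Digraph) → Vertex D → List (Vertex D) → Vertex D → Set
Path D u ws v = ArcChain D u ws v × Unique (pathVertices {D} u ws v)

StrongDiam2 : Digraph → Set
StrongDiam2 D = ∀ u v → u ≢ v →
  Arc D u v ⊎ (∃[ w ] (Arc D u w × Arc D w v))

StronglyConnectedWithout : (D : Digraph) → List (Vertex D) → Set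
StronglyConnectedWithout D X = ∀ u v → u ∉ X → v ∉ X → u ≢ v →
  ∃[ ws ] (Path D u ws v × (∀ x → x ∈ X → x ∉ ws))

-- Strong connectivity at least 2: more than 2 vertices, and D − S is
-- strongly connected for every vertex set S with |S| < 2.
TwoConnected : Digraph → Set
TwoConnected D = (n D ≥ 3) × StronglyConnectedWithout D []
               × (∀ x → StronglyConnectedWithout D (x ∷ []))

record InF (D : Digraph) (p q a b c r : Vertex D) : Set where
  field
    oriented     : Oriented D
    diam2        : StrongDiam2 D
    twoConnected : TwoConnected D
    distinct     : Unique (p ∷ q ∷ a ∷ b ∷ c ∷ r ∷ [])
    arc-pc : Arc D p c
    arc-qc : Arc D q c
    arc-qb : Arc D q b
    arc-br : Arc D b r
    arc-ar : Arc D a r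
    arc-pa : Arc D p a
    sep-p : ∀ ws → Path D p ws r →
      a ∈ pathVertices {D} p ws r
      ⊎ (c ∈ pathVertices {D} p ws r × b ∈ pathVertices {D} p ws r)
    sep-q : ∀ ws → Path D q ws r →
      b ∈ pathVertices {D} q ws r
      ⊎ (c ∈ pathVertices {D} q ws r × a ∈ pathVertices {D} q ws r)
    sep-c : ∀ ws → Path D c ws r →
      a ∈ pathVertices {D} c ws r ⊎ b ∈ pathVertices {D} c ws r

InHa : (D : Digraph) (p a c : Vertex D) → Vertex D → Set
InHa D p a c v = ∃[ ws ] (Path D p ws a × c ∉ pathVertices {D} p ws a × v ∈ ws)

InHb : (D : Digraph) (q b c : Vertex D) → Vertex D → Set
InHb D q b c v = ∃[ ws ] (Path D q ws b × c ∉ pathVertices {D} q ws b × v ∈ ws)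

-- Fix the p-side (the q-side is symmetric, with b for a).  Every p–r path meets {a, c},
-- and there is no arc c → r, since the path c → r would have to contain a or b.
-- Let v lie on a path from p to a avoiding c.  Its initial segment p … v avoids a and c,
-- and strong diameter 2 gives a route v → r or v → w → r.  Appending the route yields a
-- p–r walk, which shortens to a path, so the route must meet {a, c}: the only option
-- is w ∈ {a, c}, and w = c is impossible, so v → a.
module Submission where

open import Defs
open import Function using (_∘_; id)
open import Data.Product using (_×_; _,_; proj₁; ∃-syntax)
open import Data.Sum using (_⊎_; inj₁; inj₂; map₂)
open import Data.Empty using (⊥-elim)
open import Data.Fin using (_≟_)
open import Data.List using (List; []; _∷_; _++_)
open import Data.List.Relation.Unary.Any as Any using (Any; here; there)
open import Data.List.Relation.Unary.All as All using (All; []; _∷_)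
open import Data.List.Relation.Unary.All.Properties using (¬Any⇒All¬; All¬⇒¬Any; anti-mono; ++⁺; ++⁻ˡ)
open import Data.List.Relation.Unary.AllPairs using ([]; _∷_)
open import Data.List.Relation.Unary.Unique.Propositional using (Unique)
open import Data.List.Membership.Propositional using (_∈_; _∉_)
open import Data.List.Membership.Propositional.Properties using (∈-∃++; ∈-++⁺ʳ)
open import Data.List.Relation.Binary.Subset.Propositional using (_⊆_)
open import Data.List.Relation.Binary.Subset.Propositional.Properties using (∷⁺ʳ; ++⁺ʳ; ++⁺ˡ)
open import Relation.Nullary using (¬_; yes; no)
open import Relation.Binary.PropositionalEquality using (_≢_; refl; sym)

module _ {A : Set} where

  Unique-snoc⇒All≢ : ∀ {y : A} xs → Unique (xs ++ y ∷ []) → All (_≢ y) xs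
  Unique-snoc⇒All≢ []       _          = []
  Unique-snoc⇒All≢ (x ∷ xs) (x≢ ∷ xs!) =
    All.lookup x≢ (∈-++⁺ʳ xs (here refl)) ∷ Unique-snoc⇒All≢ xs xs!

  ∉-pair : ∀ {y x z : A} → y ≢ x → y ≢ z → y ∉ x ∷ z ∷ []
  ∉-pair y≢x _   (here y≡x)         = y≢x y≡x
  ∉-pair _   y≢z (there (here y≡z)) = y≢z y≡z

  ∈⊎∈⇒Any∈-pair : ∀ {x y} {l : List A} → x ∈ l ⊎ y ∈ l → Any (_∈ x ∷ y ∷ []) l
  ∈⊎∈⇒Any∈-pair (inj₁ x∈l) = Any.map (λ { refl → here refl }) x∈l
  ∈⊎∈⇒Any∈-pair (inj₂ y∈l) = Any.map (λ { refl → there (here refl) }) y∈l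

module _ {D : Digraph} where
  open import Data.List.Membership.DecPropositional (_≟_ {n D}) using (_∈?_)

  arc⇒path : ∀ {u v} → u ≢ v → Arc D u v → Path D u [] v
  arc⇒path u≢v uv = uv , (u≢v ∷ []) ∷ [] ∷ []

  arcChain-snoc : ∀ {u v t} ws → ArcChain D u ws v → Arc D v t → ArcChain D u (ws ++ v ∷ []) t
  arcChain-snoc []       uv       vt = uv , vt
  arcChain-snoc (w ∷ ws) (uw , wv) vt = uw , arcChain-snoc ws wv vt

  arcChain-prefix : ∀ {u v t} xs ys → ArcChain D u (xs ++ v ∷ ys) t → ArcChain D u xs v
  arcChain-prefix []       ys (uv , _)  = uv
  arcChain-prefix (x ∷ xs) ys (ux , xt) = ux , arcChain-prefix xs ys xt

  path-suffix : ∀ {u w v} ws → Path D w ws v → u ∈ pathVertices {D} w ws v → u ≢ v →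
                ∃[ zs ] (Path D u zs v × zs ⊆ ws)
  path-suffix ws       P                    (here refl)          _   = ws , P , id
  path-suffix []       _                    (there (here refl))  u≢v = ⊥-elim (u≢v refl)
  path-suffix (w ∷ ws) ((_ , wv) , _ ∷ wv!) (there u∈)           u≢v
    with zs , P , zs⊆ws ← path-suffix ws (wv , wv!) u∈ u≢v
    = zs , P , there ∘ zs⊆ws

  walk⇒path : ∀ {u v} ws → u ≢ v → ArcChain D u ws v → ∃[ zs ] (Path D u zs v × zs ⊆ ws)
  walk⇒path []       u≢v uv = [] , arc⇒path u≢v uv , id
  walk⇒path {u} {v} (w ∷ ws) u≢v (uw , wv) with w ≟ v
  ... | yes refl = [] , arc⇒path u≢v uw , λ ()
  ... | no w≢v
    with zs , (wzv , wzv!) , zs⊆ws ← walk⇒path ws w≢v wv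
    with u ∈? pathVertices {D} w zs v
  ... | no u∉ = w ∷ zs , ((uw , wzv) , ¬Any⇒All¬ _ u∉ ∷ wzv!) , ∷⁺ʳ w zs⊆ws
  ... | yes u∈ with ys , P , ys⊆zs ← path-suffix zs (wzv , wzv!) u∈ u≢v
    = ys , P , there ∘ zs⊆ws ∘ ys⊆zs

Separates : (D : Digraph) → List (Vertex D) → Vertex D → Vertex D → Set
Separates D X s t = ∀ ws → Path D s ws t → Any (_∈ X) (pathVertices {D} s ws t)

module _ {D : Digraph} {X : List (Vertex D)} {s r : Vertex D}
         (X-separates : Separates D X s r) (s≢r : s ≢ r) (r∉X : r ∉ X) where
  open import Data.List.Membership.DecPropositional (_≟_ {n D}) using (_∈?_)

  separated⇒¬avoiding-walk : ∀ ws → ArcChain D s ws r → ¬ All (_∉ X) (pathVertices {D} s ws r)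
  separated⇒¬avoiding-walk ws walk avoid with zs , P , zs⊆ws ← walk⇒path ws s≢r walk =
    All¬⇒¬Any (anti-mono (∷⁺ʳ s (++⁺ˡ (r ∷ []) zs⊆ws)) avoid) (X-separates zs P)

  avoiding-walk⇒arc-into-separator :
    StrongDiam2 D → ∀ {v} ws → ArcChain D s ws v → All (_∉ X) (pathVertices {D} s ws v) →
    ∃[ w ] (w ∈ X × Arc D v w × Arc D w r)
  avoiding-walk⇒arc-into-separator diam2 {v} ws walk avoid with v ≟ r
  ... | yes refl = ⊥-elim (separated⇒¬avoiding-walk ws walk avoid)
  ... | no v≢r with diam2 v r v≢r
  ...   | inj₁ vr = ⊥-elim (separated⇒¬avoiding-walk (ws ++ v ∷ [])
                      (arcChain-snoc ws walk vr) (++⁺ avoid (r∉X ∷ [])))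
  ...   | inj₂ (w , vw , wr) with w ∈? X
  ...     | yes w∈X = w , w∈X , vw , wr
  ...     | no w∉X = ⊥-elim (separated⇒¬avoiding-walk ((ws ++ v ∷ []) ++ w ∷ [])
                      (arcChain-snoc (ws ++ v ∷ []) (arcChain-snoc ws walk vw) wr)
                      (++⁺ (++⁺ avoid (w∉X ∷ [])) (r∉X ∷ [])))

module _ {D : Digraph} where

  avoiding-path⇒All∉-pair : ∀ {s x c} ws → Path D s ws x → c ∉ pathVertices {D} s ws x →
                            All (_∉ x ∷ c ∷ []) (s ∷ ws)
  avoiding-path⇒All∉-pair {s} ws (_ , s-ws-x!) c∉ =
    All.zipWith (λ (y≢x , c≢y) → ∉-pair y≢x (c≢y ∘ sym))
      (Unique-snoc⇒All≢ (s ∷ ws) s-ws-x! , ++⁻ˡ (s ∷ ws) (¬Any⇒All¬ _ c∉))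

  internal-vertex⇒arc-into-end :
    StrongDiam2 D → ∀ {s x c r} → Separates D (x ∷ c ∷ []) s r → ¬ Arc D c r →
    s ≢ r → x ≢ r → c ≢ r →
    ∀ {v} ws → Path D s ws x → c ∉ pathVertices {D} s ws x → v ∈ ws → Arc D v x
  internal-vertex⇒arc-into-end diam2 {s} {x} {c} {r} separates ¬cr s≢r x≢r c≢r {v} ws P c∉ v∈ws
    with xs , ys , refl ← ∈-∃++ v∈ws
    with avoiding-walk⇒arc-into-separator separates s≢r (∉-pair (x≢r ∘ sym) (c≢r ∘ sym)) diam2 xs
           (arcChain-prefix xs ys (proj₁ P))
           (anti-mono (∷⁺ʳ s (++⁺ʳ xs (∷⁺ʳ v (λ ())))) (avoiding-path⇒All∉-pair ws P c∉))
  ... | _ , here refl         , vx , _  = vx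
  ... | _ , there (here refl) , _  , cr = ⊥-elim (¬cr cr)

proposition6 : (D : Digraph) (p q a b c r : Vertex D) → InF D p q a b c r →
    (∀ v → InHa D p a c v → Arc D v a) × (∀ v → InHb D q b c v → Arc D v b)
proposition6 D p q a b c r F
  with (_ ∷ _ ∷ _ ∷ _ ∷ p≢r ∷ []) ∷ (_ ∷ _ ∷ _ ∷ q≢r ∷ []) ∷ (_ ∷ a≢c ∷ a≢r ∷ [])
       ∷ (b≢c ∷ b≢r ∷ []) ∷ (c≢r ∷ []) ∷ _ ← InF.distinct F
  = (λ v (ws , P , c∉ , v∈ws) → internal-vertex⇒arc-into-end diam2 separates-pr ¬cr p≢r a≢r c≢r ws P c∉ v∈ws)
  , (λ v (ws , P , c∉ , v∈ws) → internal-vertex⇒arc-into-end diam2 separates-qr ¬cr q≢r b≢r c≢r ws P c∉ v∈ws)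
  where
    open InF F

    ¬cr : ¬ Arc D c r
    ¬cr cr with sep-c [] (arc⇒path {D} c≢r cr)
    ... | inj₁ (here a≡c)         = a≢c a≡c
    ... | inj₁ (there (here a≡r)) = a≢r a≡r
    ... | inj₂ (here b≡c)         = b≢c b≡c
    ... | inj₂ (there (here b≡r)) = b≢r b≡r

    separates-pr : Separates D (a ∷ c ∷ []) p r
    separates-pr ws P = ∈⊎∈⇒Any∈-pair (map₂ proj₁ (sep-p ws P))

    separates-qr : Separates D (b ∷ c ∷ []) q r
    separates-qr ws P = ∈⊎∈⇒Any∈-pair (map₂ proj₁ (sep-q ws P))
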